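{- If $r$ and $s$ are integers with $2\le r<s$, then the complete bipartite graph $K_{r,s}$ is not well-edge-dominated.
   Context: A set $F$ of edges of a graph is an edge dominating set if every edge not in $F$ shares an endpoint with some edge of $F$; it is minimal if no proper subset is an edge dominating set. A graph is well-edge-dominated if all its minimal edge dominating sets have the same cardinality. -}

module Defs where

open import Data.Nat using (ℕ; _+_)
open import Data.Bool using (Bool; true; false)
open import Data.Fin using (Fin)
open import Data.Product using (_×_; _,_; Σ; ∃)
open import Data.Sum using (_⊎_)
open import Data.List using (List; sum; map; allFin; cartesianProduct; length; filter)
open import Data.Bool using (T)
open import Relation.Binary.PropositionalEquality using (_≡_)
open import Relation.Nullary using (¬_)

-- The complete bipartite graph K_{r,s}: vertex set Fin r ⊎ Fin s, one part of
-- size r and one of size s. Its edges are in bijection with Fin r × Fin s: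
-- the pair (i , j) is the edge joining vertex i of the first part with
-- vertex j of the second part.
Edge : ℕ → ℕ → Set
Edge r s = Fin r × Fin s

ShareEndpoint : ∀ {r s} → Edge r s → Edge r s → Set
ShareEndpoint (i , j) (i' , j') = (i ≡ i') ⊎ (j ≡ j')

EdgeSet : ℕ → ℕ → Set
EdgeSet r s = Edge r s → Bool

_∈ₑ_ : ∀ {r s} → Edge r s → EdgeSet r s → Set
e ∈ₑ F = T (F e)

allEdges : (r s : ℕ) → List (Edge r s)
allEdges r s = cartesianProduct (allFin r) (allFin s)

∣_∣ₑ : ∀ {r s} → EdgeSet r s → ℕ
∣_∣ₑ {r} {s} F = length (filter (λ e → Data.Bool._≟_ (F e) true) (allEdges r s))

IsEDS : ∀ {r s} → EdgeSet r s → Set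
IsEDS {r} {s} F = (e : Edge r s) → ¬ (e ∈ₑ F) → Σ (Edge r s) λ f → f ∈ₑ F × ShareEndpoint e f

_⊆ₑ_ : ∀ {r s} → EdgeSet r s → EdgeSet r s → Set
G ⊆ₑ F = ∀ e → e ∈ₑ G → e ∈ₑ F

_⊂ₑ_ : ∀ {r s} → EdgeSet r s → EdgeSet r s → Set
_⊂ₑ_ {r} {s} G F = G ⊆ₑ F × Σ (Edge r s) λ e → e ∈ₑ F × ¬ (e ∈ₑ G)

IsMinimalEDS : ∀ {r s} → EdgeSet r s → Set
IsMinimalEDS {r} {s} F = IsEDS F × ((G : EdgeSet r s) → G ⊂ₑ F → ¬ IsEDS G)

WellEdgeDominatedK : ℕ → ℕ → Set
WellEdgeDominatedK r s = (F G : EdgeSet r s) → IsMinimalEDS F → IsMinimalEDS G → ∣ F ∣ₑ ≡ ∣ G ∣ₑ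

-- The star at a vertex of the r-side and a matching saturating the r-side are both minimal edge
-- dominating sets of K_{r,s}, of sizes s and r. The star is minimal because, once one of its edges
-- (v , j) is removed, the edge from another r-side vertex to j is no longer dominated (this needs
-- r ≥ 2); the matching is minimal because, once its edge (i , j) is removed, the edge from i to an
-- unmatched s-side vertex is no longer dominated (this needs r < s).
module Submission where

open import Defs
open import Data.Bool using (true; false)
open import Data.Bool.Properties using (T-≡) renaming (_≟_ to _≟ᵇ_)
open import Data.Fin using (Fin; zero; suc; toℕ; inject≤; fromℕ<; _≟_)
open import Data.Fin.Properties using (toℕ-inject≤; toℕ-fromℕ<; toℕ<n; suc-injective)
open import Data.List using ([]; _∷_; _++_; map; length; filter; tabulate; allFin; cartesianProduct)
open import Data.List.Properties using (length-++; filter-++; filter-all; filter-none; filter-accept; filter-reject; length-tabulate; map-tabulate)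
open import Data.List.Relation.Unary.All.Properties using (tabulate⁺)
open import Data.Nat.ListAction using (sum)
open import Data.Nat as ℕ using (ℕ; _+_; _*_; _≤_; _<_; s≤s)
open import Data.Nat.Properties using (<⇒≤; <⇒≢; *-zeroʳ; *-identityʳ; +-identityʳ)
open import Data.Product using (_×_; _,_)
open import Data.Sum using (inj₁; inj₂)
open import Function using (_∘_; id)
open import Function.Bundles using (Equivalence)
open import Relation.Binary.PropositionalEquality using (_≡_; _≢_; refl; sym; trans; cong; cong₂; subst; module ≡-Reasoning)
open import Relation.Nullary using (¬_; does)
open import Relation.Nullary.Decidable using (⌊_⌋; toWitness; fromWitness)
open import Relation.Unary using (Pred; Decidable)

sum-tabulate-const : ∀ {n} {f : Fin n → ℕ} {c} → (∀ i → f i ≡ c) → sum (tabulate f) ≡ n * c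
sum-tabulate-const {ℕ.zero} f≡c = refl
sum-tabulate-const {ℕ.suc n} f≡c = cong₂ _+_ (f≡c zero) (sum-tabulate-const (f≡c ∘ suc))

module _ {A : Set} {p} {P : Pred A p} (P? : Decidable P) where

  length-filter-map : ∀ {B : Set} (f : B → A) xs →
    length (filter P? (map f xs)) ≡ length (filter (P? ∘ f) xs)
  length-filter-map f [] = refl
  length-filter-map f (x ∷ xs) with does (P? (f x))
  ... | true = cong ℕ.suc (length-filter-map f xs)
  ... | false = length-filter-map f xs

  length-filter-tabulate-unique : ∀ {n} (f : Fin n → A) (k : Fin n) → P (f k) →
    (∀ j → j ≢ k → ¬ P (f j)) → length (filter P? (tabulate f)) ≡ 1
  length-filter-tabulate-unique f zero Pfk unique
    rewrite filter-accept P? {xs = tabulate (f ∘ suc)} Pfk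
          | filter-none P? (tabulate⁺ {f = f ∘ suc} (λ j → unique (suc j) λ ()))
    = refl
  length-filter-tabulate-unique f (suc k) Pfk unique
    rewrite filter-reject P? {xs = tabulate (f ∘ suc)} (unique zero λ ())
    = length-filter-tabulate-unique (f ∘ suc) k Pfk (λ j j≢k → unique (suc j) (j≢k ∘ suc-injective))

module _ {B C : Set} {p} {P : Pred (B × C) p} (P? : Decidable P) where

  length-filter-cartesianProduct : ∀ xs ys →
    length (filter P? (cartesianProduct xs ys)) ≡ sum (map (λ x → length (filter (P? ∘ (x ,_)) ys)) xs)
  length-filter-cartesianProduct [] ys = refl
  length-filter-cartesianProduct (x ∷ xs) ys = begin
    length (filter P? (map (x ,_) ys ++ cartesianProduct xs ys))
      ≡⟨ cong length (filter-++ P? (map (x ,_) ys) _) ⟩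
    length (filter P? (map (x ,_) ys) ++ filter P? (cartesianProduct xs ys))
      ≡⟨ length-++ (filter P? (map (x ,_) ys)) ⟩
    length (filter P? (map (x ,_) ys)) + length (filter P? (cartesianProduct xs ys))
      ≡⟨ cong₂ _+_ (length-filter-map P? (x ,_) ys) (length-filter-cartesianProduct xs ys) ⟩
    _ ∎
    where open ≡-Reasoning

degree : ∀ {r s} → EdgeSet r s → Fin r → ℕ
degree {s = s} F i = length (filter (λ j → F (i , j) ≟ᵇ true) (allFin s))

∣∣ₑ≡sum-degree : ∀ {r s} (F : EdgeSet r s) → ∣ F ∣ₑ ≡ sum (tabulate (degree F))
∣∣ₑ≡sum-degree {r} {s} F = trans
  (length-filter-cartesianProduct (λ e → F e ≟ᵇ true) (allFin r) (allFin s))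
  (cong sum (map-tabulate id (degree F)))

star : ∀ {r s} → EdgeSet (ℕ.suc r) s
star (zero , _) = true
star (suc _ , _) = false

star-isEDS : ∀ {r s} → IsEDS (star {r} {s})
star-isEDS (_ , j) _ = (zero , j) , _ , inj₂ refl

star-minimal : ∀ {r s} (G : EdgeSet (ℕ.suc (ℕ.suc r)) s) → G ⊂ₑ star → ¬ IsEDS G
star-minimal G (G⊆star , (zero , j) , _ , zj∉G) G-eds with G-eds (suc zero , j) (G⊆star (suc zero , j))
... | (zero , _) , zj∈G , inj₂ refl = zj∉G zj∈G
... | (suc i , j′) , e∈G , _ = G⊆star (suc i , j′) e∈G

star-isMinimalEDS : ∀ {r s} → IsMinimalEDS (star {ℕ.suc r} {s})
star-isMinimalEDS = star-isEDS , star-minimal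

∣star∣ₑ : ∀ r s → ∣ star {r} {s} ∣ₑ ≡ s
∣star∣ₑ r s = begin
  ∣ S ∣ₑ                                         ≡⟨ ∣∣ₑ≡sum-degree S ⟩
  degree S zero + sum (tabulate (degree S ∘ suc)) ≡⟨ cong₂ _+_ degree-centre degrees-leaves ⟩
  s + 0                                          ≡⟨ +-identityʳ s ⟩
  s                                              ∎
  where
  open ≡-Reasoning
  S : EdgeSet (ℕ.suc r) s
  S = star
  degree-centre : degree S zero ≡ s
  degree-centre = trans (cong length (filter-all (λ j → S (zero , j) ≟ᵇ true) {allFin s} (tabulate⁺ λ _ → refl)))
    (length-tabulate id)
  degree-leaf : ∀ i → degree S (suc i) ≡ 0
  degree-leaf i = cong length (filter-none (λ j → S (suc i , j) ≟ᵇ true) {allFin s} (tabulate⁺ λ _ ()))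
  degrees-leaves : sum (tabulate (degree S ∘ suc)) ≡ 0
  degrees-leaves = trans (sum-tabulate-const degree-leaf) (*-zeroʳ r)

module _ {r s} (r≤s : r ≤ s) where

  matching : EdgeSet r s
  matching (i , j) = ⌊ inject≤ i r≤s ≟ j ⌋

  matching-isEDS : IsEDS matching
  matching-isEDS (i , _) _ = (i , inject≤ i r≤s) , fromWitness refl , inj₁ refl

  degree-matching : ∀ i → degree matching i ≡ 1
  degree-matching i = length-filter-tabulate-unique (λ j → matching (i , j) ≟ᵇ true) id k
    (Equivalence.to T-≡ (fromWitness refl))
    (λ j j≢k → j≢k ∘ sym ∘ toWitness ∘ Equivalence.from T-≡)
    where
    k : Fin s
    k = inject≤ i r≤s

  ∣matching∣ₑ : ∣ matching ∣ₑ ≡ r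
  ∣matching∣ₑ = trans (∣∣ₑ≡sum-degree matching) (trans (sum-tabulate-const degree-matching) (*-identityʳ r))

module _ {r s} (r<s : r < s) where

  private
    unmatched : Fin s
    unmatched = fromℕ< r<s

    inject≤≢unmatched : ∀ i → inject≤ i (<⇒≤ r<s) ≢ unmatched
    inject≤≢unmatched i eq = <⇒≢ (toℕ<n i) (begin
      toℕ i                      ≡⟨ sym (toℕ-inject≤ i (<⇒≤ r<s)) ⟩
      toℕ (inject≤ i (<⇒≤ r<s)) ≡⟨ cong toℕ eq ⟩
      toℕ unmatched              ≡⟨ toℕ-fromℕ< r<s ⟩
      r                          ∎)
      where open ≡-Reasoning

  matching-minimal : (G : EdgeSet r s) → G ⊂ₑ matching (<⇒≤ r<s) → ¬ IsEDS G
  matching-minimal G (G⊆M , (i , j) , ij∈M , ij∉G) G-eds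
    with G-eds (i , unmatched) (inject≤≢unmatched i ∘ toWitness ∘ G⊆M (i , unmatched))
  ... | (_ , j′) , ij′∈G , inj₁ refl =
    ij∉G (subst (λ x → (i , x) ∈ₑ G) (trans (sym (toWitness (G⊆M _ ij′∈G))) (toWitness ij∈M)) ij′∈G)
  ... | (i′ , _) , i′u∈G , inj₂ refl = inject≤≢unmatched i′ (toWitness (G⊆M _ i′u∈G))

  matching-isMinimalEDS : IsMinimalEDS (matching (<⇒≤ r<s))
  matching-isMinimalEDS = matching-isEDS (<⇒≤ r<s) , matching-minimal

lemma5 : (r s : ℕ) → 2 ≤ r → r < s → ¬ WellEdgeDominatedK r s
lemma5 1 s (s≤s ())
lemma5 (ℕ.suc (ℕ.suc r)) s _ r<s wed = <⇒≢ r<s (sym (begin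
  s                               ≡⟨ sym (∣star∣ₑ (ℕ.suc r) s) ⟩
  ∣ star {ℕ.suc r} {s} ∣ₑ         ≡⟨ wed star _ star-isMinimalEDS (matching-isMinimalEDS r<s) ⟩
  ∣ matching (<⇒≤ r<s) ∣ₑ         ≡⟨ ∣matching∣ₑ (<⇒≤ r<s) ⟩
  ℕ.suc (ℕ.suc r)                 ∎))
  where open ≡-Reasoning
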